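{- For every set $\Gamma\cup\{A\}$ of propositional formulas: if $\Gamma\models_{i3g3}A$ then $\Gamma\models_4A$.
   Context: Propositional language: propositional variables, $\bot$, ${\sim}$, $\land,\lor,\to$; $\neg A:=A\to\bot$. A propositional $\mathbf{BDi3}$-model is $\langle W,\le,V\rangle$ with $\le$ a partial order on nonempty $W$ having maximal successors, and $V(w,p)\subseteq\{0,1\}$ not containing both $0,1$, monotone along $\le$, and potentially omniscient (for all $x\ge w$ there is $y\ge x$ with $V(y,p)\ne\emptyset$). $I(w,A)\subseteq\{0,1\}$ extends $V$: $I(w,p)=V(w,p)$; $1\notin I(w,\bot)$, $0\in I(w,\bot)$; $1\in I(w,{\sim}A)$ iff $0\in I(w,A)$; $0\in I(w,{\sim}A)$ iff $1\in I(w,A)$; $1\in I(w,A\land B)$ iff both; $0\in I(w,A\land B)$ iff $0\in I(w,A)$ or $0\in I(w,B)$; $1\in I(w,A\lor B)$ iff $1\in I(w,A)$ or $1\in I(w,B)$; $0\in I(w,A\lor B)$ iff both have $0$; $1\in I(w,A\to B)$ iff for all $x\ge w$, $1\notin I(x,A)$ or $1\in I(x,B)$; $0\in I(w,A\to B)$ iff ($0\notin I(x,A)$ for all $x\ge w$) and $0\in I(w,B)$. $\Gamma\models_{i3g3}A$ iff for every such model with $\le$ linear and $|W|\le2$ and every $w$, if $1\in I(w,B)$ for all $B\in\Gamma$ then $1\in I(w,A)$. Four-valued semantics with values $\mathbf 1,\mathbf i,\mathbf j,\mathbf 0$, linearly ordered $\mathbf 0<\mathbf j<\mathbf i<\mathbf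 1$: $\bot$ has value $\mathbf 0$; $a\land b=\min(a,b)$, $a\lor b=\max(a,b)$; ${\sim}$: $\mathbf 1\mapsto\mathbf 0$, $\mathbf i\mapsto\mathbf j$, $\mathbf j\mapsto\mathbf i$, $\mathbf 0\mapsto\mathbf 1$; $\neg$: $\mathbf 1,\mathbf i\mapsto\mathbf 0$ and $\mathbf j,\mathbf 0\mapsto\mathbf 1$; $a\to b$: if $a\in\{\mathbf j,\mathbf 0\}$ then $\mathbf 1$; if $a=\mathbf 1$ then $b$; if $a=\mathbf i$ then $\mathbf 1$ for $b\in\{\mathbf 1,\mathbf i\}$ and $b$ for $b\in\{\mathbf j,\mathbf 0\}$. $\Gamma\models_4A$ iff every assignment of the four values to propositional variables, extended by these tables, that gives all $B\in\Gamma$ the value $\mathbf 1$ gives $A$ the value $\mathbf 1$. -}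

module Defs where

open import Data.Nat using (ℕ)
open import Data.Empty using (⊥)
open import Data.Unit using (⊤)
open import Data.Product using (Σ; ∃; _×_; _,_)
open import Data.Sum using (_⊎_)
open import Relation.Nullary using (¬_)
open import Relation.Binary.PropositionalEquality using (_≡_)

data Form : Set where
  var  : ℕ → Form
  bot  : Form
  ∼_   : Form → Form
  _∧_  : Form → Form → Form
  _∨_  : Form → Form → Form
  _⇒_  : Form → Form → Form

neg : Form → Form
neg A = A ⇒ bot

-- Propositional BDi3-models.  V(w,p) ⊆ {0,1} is represented by two
-- predicates: V1 w p ("1 ∈ V(w,p)") and V0 w p ("0 ∈ V(w,p)").

record BDi3Model : Set₁ where
  field
    W        : Set
    w₀       : W
    _≤_      : W → W → Set
    ≤-refl   : ∀ w → w ≤ w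
    ≤-trans  : ∀ {x y z} → x ≤ y → y ≤ z → x ≤ z
    ≤-antisym : ∀ {x y} → x ≤ y → y ≤ x → x ≡ y
    maxSucc  : ∀ w → Σ W λ m → (w ≤ m) × (∀ x → m ≤ x → x ≡ m)
    V1       : W → ℕ → Set
    V0       : W → ℕ → Set
    V-cons   : ∀ w p → ¬ (V1 w p × V0 w p)
    V1-mono  : ∀ {w x} p → w ≤ x → V1 w p → V1 x p
    V0-mono  : ∀ {w x} p → w ≤ x → V0 w p → V0 x p
    potOmni  : ∀ w p x → w ≤ x → Σ W λ y → (x ≤ y) × (V1 y p ⊎ V0 y p)

module _ (M : BDi3Model) where
  open BDi3Model M

  -- I1 w A : "1 ∈ I(w,A)",  I0 w A : "0 ∈ I(w,A)"
  I1 : W → Form → Set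
  I0 : W → Form → Set
  I1 w (var p)  = V1 w p
  I1 w bot      = ⊥
  I1 w (∼ A)    = I0 w A
  I1 w (A ∧ B)  = I1 w A × I1 w B
  I1 w (A ∨ B)  = I1 w A ⊎ I1 w B
  I1 w (A ⇒ B)  = ∀ x → w ≤ x → I1 x A → I1 x B
  I0 w (var p)  = V0 w p
  I0 w bot      = ⊤
  I0 w (∼ A)    = I1 w A
  I0 w (A ∧ B)  = I0 w A ⊎ I0 w B
  I0 w (A ∨ B)  = I0 w A × I0 w B
  I0 w (A ⇒ B)  = (∀ x → w ≤ x → ¬ I0 x A) × I0 w B

Linear : BDi3Model → Set
Linear M = ∀ x y → (x ≤ y) ⊎ (y ≤ x)
  where open BDi3Model M

AtMostTwo : BDi3Model → Set
AtMostTwo M = ∀ (x y z : W) → (x ≡ y) ⊎ (y ≡ z) ⊎ (x ≡ z)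
  where open BDi3Model M

_⊨i3g3_ : (Form → Set) → Form → Set₁
Γ ⊨i3g3 A = ∀ (M : BDi3Model) → Linear M → AtMostTwo M →
            ∀ (w : BDi3Model.W M) → (∀ B → Γ B → I1 M w B) → I1 M w A

-- Four-valued semantics, 0 < j < i < 1

data V4 : Set where
  𝟏 𝐢 𝐣 𝟎 : V4

min4 : V4 → V4 → V4
min4 𝟎 b = 𝟎
min4 𝐣 𝟎 = 𝟎
min4 𝐣 b = 𝐣
min4 𝐢 𝟏 = 𝐢
min4 𝐢 b = b
min4 𝟏 b = b

max4 : V4 → V4 → V4
max4 𝟏 b = 𝟏
max4 𝐢 𝟏 = 𝟏
max4 𝐢 b = 𝐢
max4 𝐣 𝟎 = 𝐣
max4 𝐣 b = b
max4 𝟎 b = b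

sneg4 : V4 → V4
sneg4 𝟏 = 𝟎
sneg4 𝐢 = 𝐣
sneg4 𝐣 = 𝐢
sneg4 𝟎 = 𝟏

imp4 : V4 → V4 → V4
imp4 𝐣 b = 𝟏
imp4 𝟎 b = 𝟏
imp4 𝟏 b = b
imp4 𝐢 𝟏 = 𝟏
imp4 𝐢 𝐢 = 𝟏
imp4 𝐢 𝐣 = 𝐣
imp4 𝐢 𝟎 = 𝟎

eval4 : (ℕ → V4) → Form → V4
eval4 v (var p) = v p
eval4 v bot     = 𝟎
eval4 v (∼ A)   = sneg4 (eval4 v A)
eval4 v (A ∧ B) = min4 (eval4 v A) (eval4 v B)
eval4 v (A ∨ B) = max4 (eval4 v A) (eval4 v B)
eval4 v (A ⇒ B) = imp4 (eval4 v A) (eval4 v B)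

_⊨4_ : (Form → Set) → Form → Set
Γ ⊨4 A = ∀ (v : ℕ → V4) → (∀ B → Γ B → eval4 v B ≡ 𝟏) → eval4 v A ≡ 𝟏

module Submission where

-- A four-valued assignment is read as a two-world linear model root ≼ top.
-- The values 𝟏, 𝐢, 𝐣, 𝟎 are exactly the four bilateral statuses that are
-- monotone along root ≼ top and decided at top: true at both worlds, true
-- only at top, false only at top, false at both.  The four-valued tables
-- compute these statuses compositionally, so by induction on formulas the
-- value of A is 𝟏 iff A is true at root, and i3g3-validity at the root of
-- the induced model gives four-valued validity.

open import Defs
open import Data.Nat using (ℕ)
open import Data.Bool using (Bool; true; false; T; not) renaming (_∧_ to _∧ᵇ_; _∨_ to _∨ᵇ_)
open import Data.Bool.Properties using (T-∧; T-∨)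
open import Data.Product using (_×_; _,_)
open import Data.Product.Function.NonDependent.Propositional using (_×-⇔_)
open import Data.Sum using (_⊎_; inj₁; inj₂)
open import Data.Sum.Function.Propositional using (_⊎-⇔_)
open import Function.Bundles using (_⇔_; mk⇔; module Equivalence)
open Equivalence using (to; from)
open import Function.Properties.Equivalence using (⇔-setoid) renaming (refl to ⇔-refl)
open import Function.Related.TypeIsomorphisms using (→-cong-⇔; ¬-cong-⇔)
open import Level using (0ℓ)
open import Relation.Nullary using (¬_)
open import Relation.Binary.PropositionalEquality using (_≡_; refl; cong)
import Relation.Binary.Reasoning.Setoid as SetoidReasoning

data World : Set where
  root top : World

data _≼_ : World → World → Set where
  root≼   : ∀ {w} → root ≼ w
  top≼top : top ≼ top

≼-refl : ∀ w → w ≼ w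
≼-refl root = root≼
≼-refl top  = top≼top

≼-trans : ∀ {x y z} → x ≼ y → y ≼ z → x ≼ z
≼-trans root≼   _ = root≼
≼-trans top≼top q = q

≼-antisym : ∀ {x y} → x ≼ y → y ≼ x → x ≡ y
≼-antisym root≼   root≼ = refl
≼-antisym top≼top _     = refl

≼-top : ∀ w → w ≼ top
≼-top root = root≼
≼-top top  = top≼top

≼-total : ∀ x y → (x ≼ y) ⊎ (y ≼ x)
≼-total root y = inj₁ root≼
≼-total top  y = inj₂ (≼-top y)

top-maximal : ∀ x → top ≼ x → x ≡ top
top-maximal top top≼top = refl

World-atMostTwo : ∀ (x y z : World) → (x ≡ y) ⊎ (y ≡ z) ⊎ (x ≡ z)
World-atMostTwo root root _    = inj₁ refl
World-atMostTwo top  top  _    = inj₁ refl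
World-atMostTwo root top  root = inj₂ (inj₂ refl)
World-atMostTwo root top  top  = inj₂ (inj₁ refl)
World-atMostTwo top  root root = inj₂ (inj₁ refl)
World-atMostTwo top  root top  = inj₂ (inj₂ refl)

allAbove : World → (World → Bool) → Bool
allAbove root b = b root ∧ᵇ b top
allAbove top  b = b top

T-allAbove : ∀ w (b : World → Bool) → T (allAbove w b) ⇔ (∀ x → w ≼ x → T (b x))
T-allAbove root b = mk⇔ (λ h → everywhere (to T-∧ h))
                        (λ h → from T-∧ (h root root≼ , h top root≼))
  where
  everywhere : T (b root) × T (b top) → ∀ x → root ≼ x → T (b x)
  everywhere (r , _) root root≼ = r
  everywhere (_ , t) top  root≼ = t
T-allAbove top b = mk⇔ (λ { h top top≼top → h }) (λ h → h top top≼top)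

∀≼-cong : ∀ {w} {P Q : World → Set} → (∀ x → P x ⇔ Q x) →
          (∀ x → w ≼ x → P x) ⇔ (∀ x → w ≼ x → Q x)
∀≼-cong P⇔Q = mk⇔ (λ h x w≼x → to   (P⇔Q x) (h x w≼x))
                  (λ h x w≼x → from (P⇔Q x) (h x w≼x))

T-not : ∀ b → T (not b) ⇔ (¬ T b)
T-not true  = mk⇔ (λ ()) (λ ¬⊤ → ¬⊤ _)
T-not false = mk⇔ (λ _ ()) _

T-implies : ∀ b c → T (not b ∨ᵇ c) ⇔ (T b → T c)
T-implies true  c = mk⇔ (λ t _ → t) (λ h → h _)
T-implies false c = mk⇔ (λ _ ()) _

isTrue : World → V4 → Bool
isTrue _    𝟏 = true
isTrue _    𝐣 = false
isTrue _    𝟎 = false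
isTrue root 𝐢 = false
isTrue top  𝐢 = true

isFalse : World → V4 → Bool
isFalse _    𝟎 = true
isFalse _    𝐢 = false
isFalse _    𝟏 = false
isFalse root 𝐣 = false
isFalse top  𝐣 = true

isTrue-mono : ∀ {w x} e → w ≼ x → T (isTrue w e) → T (isTrue x e)
isTrue-mono {top}  e top≼top t = t
isTrue-mono {root} 𝟏 _       t = t

isFalse-mono : ∀ {w x} e → w ≼ x → T (isFalse w e) → T (isFalse x e)
isFalse-mono {top}  e top≼top t = t
isFalse-mono {root} 𝟎 _       t = t

isTrue-isFalse-disjoint : ∀ w e → ¬ (T (isTrue w e) × T (isFalse w e))
isTrue-isFalse-disjoint top  𝐢 (_ , ())
isTrue-isFalse-disjoint top  𝐣 (() , _)

isTrue-or-isFalse-top : ∀ e → T (isTrue top e) ⊎ T (isFalse top e)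
isTrue-or-isFalse-top 𝟏 = inj₁ _
isTrue-or-isFalse-top 𝐢 = inj₁ _
isTrue-or-isFalse-top 𝐣 = inj₂ _
isTrue-or-isFalse-top 𝟎 = inj₂ _

isTrue-root : ∀ e → T (isTrue root e) ⇔ (e ≡ 𝟏)
isTrue-root 𝟏 = mk⇔ (λ _ → refl) _
isTrue-root 𝐢 = mk⇔ (λ ()) (λ ())
isTrue-root 𝐣 = mk⇔ (λ ()) (λ ())
isTrue-root 𝟎 = mk⇔ (λ ()) (λ ())

isTrue-sneg4 : ∀ w e → isTrue w (sneg4 e) ≡ isFalse w e
isTrue-sneg4 w    𝟏 = refl
isTrue-sneg4 w    𝐢 = refl
isTrue-sneg4 root 𝐣 = refl
isTrue-sneg4 top  𝐣 = refl
isTrue-sneg4 w    𝟎 = refl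

isFalse-sneg4 : ∀ w e → isFalse w (sneg4 e) ≡ isTrue w e
isFalse-sneg4 w    𝟏 = refl
isFalse-sneg4 root 𝐢 = refl
isFalse-sneg4 top  𝐢 = refl
isFalse-sneg4 w    𝐣 = refl
isFalse-sneg4 w    𝟎 = refl

isTrue-min4 : ∀ w e f → isTrue w (min4 e f) ≡ isTrue w e ∧ᵇ isTrue w f
isTrue-min4 w    𝟏 f = refl
isTrue-min4 root 𝐢 𝟏 = refl
isTrue-min4 top  𝐢 𝟏 = refl
isTrue-min4 root 𝐢 𝐢 = refl
isTrue-min4 top  𝐢 𝐢 = refl
isTrue-min4 root 𝐢 𝐣 = refl
isTrue-min4 top  𝐢 𝐣 = refl
isTrue-min4 root 𝐢 𝟎 = refl
isTrue-min4 top  𝐢 𝟎 = refl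
isTrue-min4 w    𝐣 𝟏 = refl
isTrue-min4 w    𝐣 𝐢 = refl
isTrue-min4 w    𝐣 𝐣 = refl
isTrue-min4 w    𝐣 𝟎 = refl
isTrue-min4 w    𝟎 f = refl

isFalse-min4 : ∀ w e f → isFalse w (min4 e f) ≡ isFalse w e ∨ᵇ isFalse w f
isFalse-min4 w    𝟏 f = refl
isFalse-min4 w    𝐢 𝟏 = refl
isFalse-min4 w    𝐢 𝐢 = refl
isFalse-min4 w    𝐢 𝐣 = refl
isFalse-min4 w    𝐢 𝟎 = refl
isFalse-min4 root 𝐣 𝟏 = refl
isFalse-min4 top  𝐣 𝟏 = refl
isFalse-min4 root 𝐣 𝐢 = refl
isFalse-min4 top  𝐣 𝐢 = refl
isFalse-min4 root 𝐣 𝐣 = refl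
isFalse-min4 top  𝐣 𝐣 = refl
isFalse-min4 root 𝐣 𝟎 = refl
isFalse-min4 top  𝐣 𝟎 = refl
isFalse-min4 w    𝟎 f = refl

isTrue-max4 : ∀ w e f → isTrue w (max4 e f) ≡ isTrue w e ∨ᵇ isTrue w f
isTrue-max4 w    𝟏 f = refl
isTrue-max4 root 𝐢 𝟏 = refl
isTrue-max4 top  𝐢 𝟏 = refl
isTrue-max4 root 𝐢 𝐢 = refl
isTrue-max4 top  𝐢 𝐢 = refl
isTrue-max4 root 𝐢 𝐣 = refl
isTrue-max4 top  𝐢 𝐣 = refl
isTrue-max4 root 𝐢 𝟎 = refl
isTrue-max4 top  𝐢 𝟎 = refl
isTrue-max4 w    𝐣 𝟏 = refl
isTrue-max4 w    𝐣 𝐢 = refl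
isTrue-max4 w    𝐣 𝐣 = refl
isTrue-max4 w    𝐣 𝟎 = refl
isTrue-max4 w    𝟎 f = refl

isFalse-max4 : ∀ w e f → isFalse w (max4 e f) ≡ isFalse w e ∧ᵇ isFalse w f
isFalse-max4 w    𝟏 f = refl
isFalse-max4 w    𝐢 𝟏 = refl
isFalse-max4 w    𝐢 𝐢 = refl
isFalse-max4 w    𝐢 𝐣 = refl
isFalse-max4 w    𝐢 𝟎 = refl
isFalse-max4 root 𝐣 𝟏 = refl
isFalse-max4 top  𝐣 𝟏 = refl
isFalse-max4 root 𝐣 𝐢 = refl
isFalse-max4 top  𝐣 𝐢 = refl
isFalse-max4 root 𝐣 𝐣 = refl
isFalse-max4 top  𝐣 𝐣 = refl
isFalse-max4 root 𝐣 𝟎 = refl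
isFalse-max4 top  𝐣 𝟎 = refl
isFalse-max4 w    𝟎 f = refl

isTrue-imp4 : ∀ w e f →
              isTrue w (imp4 e f) ≡ allAbove w (λ x → not (isTrue x e) ∨ᵇ isTrue x f)
isTrue-imp4 root 𝟏 𝟏 = refl
isTrue-imp4 root 𝟏 𝐢 = refl
isTrue-imp4 root 𝟏 𝐣 = refl
isTrue-imp4 root 𝟏 𝟎 = refl
isTrue-imp4 root 𝐢 𝟏 = refl
isTrue-imp4 root 𝐢 𝐢 = refl
isTrue-imp4 root 𝐢 𝐣 = refl
isTrue-imp4 root 𝐢 𝟎 = refl
isTrue-imp4 root 𝐣 f = refl
isTrue-imp4 root 𝟎 f = refl
isTrue-imp4 top  𝟏 f = refl
isTrue-imp4 top  𝐢 𝟏 = refl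
isTrue-imp4 top  𝐢 𝐢 = refl
isTrue-imp4 top  𝐢 𝐣 = refl
isTrue-imp4 top  𝐢 𝟎 = refl
isTrue-imp4 top  𝐣 f = refl
isTrue-imp4 top  𝟎 f = refl

isFalse-imp4 : ∀ w e f →
               isFalse w (imp4 e f) ≡ allAbove w (λ x → not (isFalse x e)) ∧ᵇ isFalse w f
isFalse-imp4 root 𝟏 f = refl
isFalse-imp4 root 𝐢 𝟏 = refl
isFalse-imp4 root 𝐢 𝐢 = refl
isFalse-imp4 root 𝐢 𝐣 = refl
isFalse-imp4 root 𝐢 𝟎 = refl
isFalse-imp4 root 𝐣 f = refl
isFalse-imp4 root 𝟎 f = refl
isFalse-imp4 top  𝟏 f = refl
isFalse-imp4 top  𝐢 𝟏 = refl
isFalse-imp4 top  𝐢 𝐢 = refl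
isFalse-imp4 top  𝐢 𝐣 = refl
isFalse-imp4 top  𝐢 𝟎 = refl
isFalse-imp4 top  𝐣 f = refl
isFalse-imp4 top  𝟎 f = refl

inducedModel : (ℕ → V4) → BDi3Model
inducedModel v = record
  { W         = World
  ; w₀        = root
  ; _≤_       = _≼_
  ; ≤-refl    = ≼-refl
  ; ≤-trans   = ≼-trans
  ; ≤-antisym = ≼-antisym
  ; maxSucc   = λ w → top , ≼-top w , top-maximal
  ; V1        = λ w p → T (isTrue w (v p))
  ; V0        = λ w p → T (isFalse w (v p))
  ; V-cons    = λ w p → isTrue-isFalse-disjoint w (v p)
  ; V1-mono   = λ p → isTrue-mono (v p)
  ; V0-mono   = λ p → isFalse-mono (v p)
  ; potOmni   = λ _ p x _ → top , ≼-top x , isTrue-or-isFalse-top (v p)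
  }

module _ (v : ℕ → V4) where
  open SetoidReasoning (⇔-setoid 0ℓ)

  private
    M : BDi3Model
    M = inducedModel v

    ⟦_⟧ : Form → V4
    ⟦_⟧ = eval4 v

  truth-lemma   : ∀ w A → T (isTrue w ⟦ A ⟧) ⇔ I1 M w A
  falsity-lemma : ∀ w A → T (isFalse w ⟦ A ⟧) ⇔ I0 M w A

  truth-lemma w (var p) = ⇔-refl
  truth-lemma w bot     = ⇔-refl
  truth-lemma w (∼ A)   = begin
    T (isTrue w (sneg4 ⟦ A ⟧)) ≡⟨ cong T (isTrue-sneg4 w ⟦ A ⟧) ⟩
    T (isFalse w ⟦ A ⟧)        ≈⟨ falsity-lemma w A ⟩
    I0 M w A                   ∎
  truth-lemma w (A ∧ B) = begin
    T (isTrue w (min4 ⟦ A ⟧ ⟦ B ⟧))           ≡⟨ cong T (isTrue-min4 w ⟦ A ⟧ ⟦ B ⟧) ⟩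
    T (isTrue w ⟦ A ⟧ ∧ᵇ isTrue w ⟦ B ⟧)      ≈⟨ T-∧ ⟩
    (T (isTrue w ⟦ A ⟧) × T (isTrue w ⟦ B ⟧)) ≈⟨ truth-lemma w A ×-⇔ truth-lemma w B ⟩
    (I1 M w A × I1 M w B)                     ∎
  truth-lemma w (A ∨ B) = begin
    T (isTrue w (max4 ⟦ A ⟧ ⟦ B ⟧))           ≡⟨ cong T (isTrue-max4 w ⟦ A ⟧ ⟦ B ⟧) ⟩
    T (isTrue w ⟦ A ⟧ ∨ᵇ isTrue w ⟦ B ⟧)      ≈⟨ T-∨ ⟩
    (T (isTrue w ⟦ A ⟧) ⊎ T (isTrue w ⟦ B ⟧)) ≈⟨ truth-lemma w A ⊎-⇔ truth-lemma w B ⟩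
    (I1 M w A ⊎ I1 M w B)                     ∎
  truth-lemma w (A ⇒ B) = begin
    T (isTrue w (imp4 ⟦ A ⟧ ⟦ B ⟧))
      ≡⟨ cong T (isTrue-imp4 w ⟦ A ⟧ ⟦ B ⟧) ⟩
    T (allAbove w (λ x → not (isTrue x ⟦ A ⟧) ∨ᵇ isTrue x ⟦ B ⟧))
      ≈⟨ T-allAbove w _ ⟩
    (∀ x → w ≼ x → T (not (isTrue x ⟦ A ⟧) ∨ᵇ isTrue x ⟦ B ⟧))
      ≈⟨ ∀≼-cong (λ x → T-implies _ _) ⟩
    (∀ x → w ≼ x → T (isTrue x ⟦ A ⟧) → T (isTrue x ⟦ B ⟧))
      ≈⟨ ∀≼-cong (λ x → →-cong-⇔ (truth-lemma x A) (truth-lemma x B)) ⟩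
    (∀ x → w ≼ x → I1 M x A → I1 M x B)
      ∎

  falsity-lemma w (var p) = ⇔-refl
  falsity-lemma w bot     = ⇔-refl
  falsity-lemma w (∼ A)   = begin
    T (isFalse w (sneg4 ⟦ A ⟧)) ≡⟨ cong T (isFalse-sneg4 w ⟦ A ⟧) ⟩
    T (isTrue w ⟦ A ⟧)          ≈⟨ truth-lemma w A ⟩
    I1 M w A                    ∎
  falsity-lemma w (A ∧ B) = begin
    T (isFalse w (min4 ⟦ A ⟧ ⟦ B ⟧))            ≡⟨ cong T (isFalse-min4 w ⟦ A ⟧ ⟦ B ⟧) ⟩
    T (isFalse w ⟦ A ⟧ ∨ᵇ isFalse w ⟦ B ⟧)      ≈⟨ T-∨ ⟩
    (T (isFalse w ⟦ A ⟧) ⊎ T (isFalse w ⟦ B ⟧)) ≈⟨ falsity-lemma w A ⊎-⇔ falsity-lemma w B ⟩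
    (I0 M w A ⊎ I0 M w B)                       ∎
  falsity-lemma w (A ∨ B) = begin
    T (isFalse w (max4 ⟦ A ⟧ ⟦ B ⟧))            ≡⟨ cong T (isFalse-max4 w ⟦ A ⟧ ⟦ B ⟧) ⟩
    T (isFalse w ⟦ A ⟧ ∧ᵇ isFalse w ⟦ B ⟧)      ≈⟨ T-∧ ⟩
    (T (isFalse w ⟦ A ⟧) × T (isFalse w ⟦ B ⟧)) ≈⟨ falsity-lemma w A ×-⇔ falsity-lemma w B ⟩
    (I0 M w A × I0 M w B)                       ∎
  falsity-lemma w (A ⇒ B) = begin
    T (isFalse w (imp4 ⟦ A ⟧ ⟦ B ⟧))
      ≡⟨ cong T (isFalse-imp4 w ⟦ A ⟧ ⟦ B ⟧) ⟩
    T (allAbove w (λ x → not (isFalse x ⟦ A ⟧)) ∧ᵇ isFalse w ⟦ B ⟧)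
      ≈⟨ T-∧ ⟩
    (T (allAbove w (λ x → not (isFalse x ⟦ A ⟧))) × T (isFalse w ⟦ B ⟧))
      ≈⟨ T-allAbove w _ ×-⇔ ⇔-refl ⟩
    ((∀ x → w ≼ x → T (not (isFalse x ⟦ A ⟧))) × T (isFalse w ⟦ B ⟧))
      ≈⟨ ∀≼-cong (λ x → T-not _) ×-⇔ ⇔-refl ⟩
    ((∀ x → w ≼ x → ¬ T (isFalse x ⟦ A ⟧)) × T (isFalse w ⟦ B ⟧))
      ≈⟨ ∀≼-cong (λ x → ¬-cong-⇔ (falsity-lemma x A)) ×-⇔ falsity-lemma w B ⟩
    ((∀ x → w ≼ x → ¬ I0 M x A) × I0 M w B)
      ∎

theorem4p2 : (Γ : Form → Set) (A : Form) → Γ ⊨i3g3 A → Γ ⊨4 A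
theorem4p2 Γ A Γ⊨A v Γ≡𝟏 =
  to (isTrue-root (eval4 v A)) (from (truth-lemma v root A) A-true-at-root)
  where
  Γ-true-at-root : ∀ B → Γ B → I1 (inducedModel v) root B
  Γ-true-at-root B B∈Γ = to (truth-lemma v root B) (from (isTrue-root (eval4 v B)) (Γ≡𝟏 B B∈Γ))

  A-true-at-root : I1 (inducedModel v) root A
  A-true-at-root = Γ⊨A (inducedModel v) ≼-total World-atMostTwo root Γ-true-at-root
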